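{- Let $G$ be a graph with $\mathrm{bdim}(G)=k$, and let $H$ be any subgraph of $G$ with $\mathrm{diam}(H)=d$. Then $|V(H)|\le (d+1)^k$.
   Context: All graphs are finite, simple and undirected. For vertices $x,y$ of a graph $G$, $d(x,y)$ is the length of a shortest $x$–$y$ path in $G$ ($\infty$ if $x,y$ lie in different components); $\mathrm{diam}(H)=\max\{d_H(x,y): x,y\in V(H)\}$. For a positive integer $k$, let $d_k(x,y)=\min\{d(x,y),k+1\}$. A function $f:V(G)\to\mathbb{Z}_{\ge 0}$ is a resolving broadcast of $G$ if for any two distinct $x,y\in V(G)$ there is a vertex $z$ with $f(z)=i>0$ and $d_i(x,z)\neq d_i(y,z)$. The broadcast dimension $\mathrm{bdim}(G)$ is the minimum of $\sum_{v\in V(G)} f(v)$ over all resolving broadcasts $f$ of $G$. -}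

module Defs where

open import Data.Nat using (ℕ; zero; suc; _≤_; _<_; _^_; _+_)
open import Data.Bool using (Bool; true; false; _∨_; _∧_; if_then_else_)
open import Data.Fin using (Fin; _≟_)
open import Data.List using (List; map; allFin)
open import Data.Bool.ListAction using (any)
open import Data.Nat.ListAction using (sum)
open import Data.Product using (Σ; _×_; ∃; ∃-syntax)
open import Relation.Nullary using (¬_)
open import Relation.Nullary.Decidable using (isYes)
open import Relation.Binary.PropositionalEquality using (_≡_; _≢_)
open import Function.Definitions using (Injective)

record Graph (n : ℕ) : Set where
  field
    Adj   : Fin n → Fin n → Bool
    sym   : ∀ x y → Adj x y ≡ Adj y x
    irrefl : ∀ x → Adj x x ≡ false
open Graph public

-- reach G m x y = true  iff  d(x,y) ≤ m  (there is an x–y walk of length ≤ m).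
reach : ∀ {n} → Graph n → ℕ → Fin n → Fin n → Bool
reach G zero    x y = isYes (x ≟ y)
reach G (suc m) x y = reach G m x y ∨ any (λ z → reach G m x z ∧ Adj G z y) (allFin _)

-- Truncated distance d_k(x,y) = min{d(x,y), k+1}.
dtrunc : ∀ {n} → Graph n → ℕ → Fin n → Fin n → ℕ
dtrunc G zero    x y = if reach G zero x y then 0 else 1
dtrunc G (suc k) x y =
  if reach G k x y then dtrunc G k x y
  else (if reach G (suc k) x y then suc k else suc (suc k))

HasDist : ∀ {n} → Graph n → Fin n → Fin n → ℕ → Set
HasDist G x y zero    = reach G zero x y ≡ true
HasDist G x y (suc m) = (reach G (suc m) x y ≡ true) × (reach G m x y ≡ false)

Diam : ∀ {n} → Graph n → ℕ → Set
Diam G d = (∀ x y → reach G d x y ≡ true) × (∃[ x ] ∃[ y ] HasDist G x y d)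

IsResolvingBroadcast : ∀ {n} → Graph n → (Fin n → ℕ) → Set
IsResolvingBroadcast G f =
  ∀ x y → x ≢ y → ∃[ z ] ((0 < f z) × (dtrunc G (f z) x z ≢ dtrunc G (f z) y z))

cost : ∀ {n} → (Fin n → ℕ) → ℕ
cost {n} f = sum (map f (allFin n))

BDim : ∀ {n} → Graph n → ℕ → Set
BDim G k = (∃[ f ] (IsResolvingBroadcast G f × cost f ≡ k))
         × (∀ f → IsResolvingBroadcast G f → k ≤ cost f)

IsSubgraph : ∀ {m n} → Graph m → Graph n → (Fin m → Fin n) → Set
IsSubgraph H G ι = Injective _≡_ _≡_ ι × (∀ u v → Adj H u v ≡ true → Adj G (ι u) (ι v) ≡ true)

module Submission where

-- Give every vertex x of H the vector of truncated distances
-- h_z(x) = d_{f z}(x, z), one coordinate per broadcasting vertex z.  Since f is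
-- resolving, distinct vertices get distinct vectors.  Any two vertices of H are
-- joined in H, hence in G, by a walk of length ≤ d, so by the triangle
-- inequality for truncated distances the values of h_z on V(H) lie in an
-- interval [lo_z, lo_z + d].  Thus x ↦ (h_z(x) ∸ lo_z)_z is an injection into
-- digit vectors with d+1 values at each of the broadcasting vertices; encoding
-- them in mixed radix shows |V(H)| ≤ ∏_z radix(f z) ≤ (d+1)^(Σ_z f z).

open import Defs
open import Data.Nat
  using (ℕ; zero; suc; _+_; _*_; _∸_; _^_; _⊓_; _≤_; _<_; _≤′_; ≤′-refl; ≤′-step; z≤n; s≤s; _≤?_)
open import Data.Nat.Properties
open import Data.Nat.ListAction using (sum)
open import Data.Fin using (Fin; fromℕ<) renaming (zero to fzero; suc to fsuc; _≟_ to _≟ᶠ_)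
open import Data.Fin.Properties using (injective⇒≤; fromℕ<-injective)
open import Data.Bool using (Bool; true; false; _∨_; _∧_; if_then_else_)
open import Data.Bool.Properties using (T-≡)
open import Data.Bool.ListAction using (any)
open import Data.List using (allFin; tabulate)
open import Data.List.Properties using (map-tabulate)
open import Data.List.Relation.Unary.Any using (satisfied)
open import Data.List.Relation.Unary.Any.Properties using (any⁺; any⁻)
open import Data.List.Membership.Propositional using (lose)
open import Data.List.Membership.Propositional.Properties using (∈-allFin)
open import Data.Product using (∃; _×_; _,_; proj₁; proj₂)
open import Data.Sum using (_⊎_; inj₁; inj₂)
open import Function using (_∘_; id)
open import Function.Bundles using (Equivalence)
open import Relation.Nullary using (yes; no; contradiction)
open import Relation.Nullary.Decidable using (isYes; isYes≗does; dec-true; toWitness)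
open import Relation.Binary.PropositionalEquality
  using (_≡_; refl; cong; cong₂; subst; trans) renaming (sym to ≡-sym)
open import Relation.Binary.Definitions using (tri<; tri≈; tri>)

open Equivalence using (to; from)

any-allFin-intro : ∀ {n} (p : Fin n → Bool) (i : Fin n) →
  p i ≡ true → any p (allFin n) ≡ true
any-allFin-intro p i pi = to T-≡ (any⁺ p (lose (∈-allFin i) (from T-≡ pi)))

any-allFin-elim : ∀ {n} (p : Fin n → Bool) →
  any p (allFin n) ≡ true → ∃ λ i → p i ≡ true
any-allFin-elim {n} p holds with satisfied (any⁻ p (allFin n) (from T-≡ holds))
... | i , pi = i , to T-≡ pi

∧-true : ∀ {a b} → a ∧ b ≡ true → a ≡ true × b ≡ true
∧-true {true} {true} refl = refl , refl

≟ᶠ-refl : ∀ {n} (x : Fin n) → isYes (x ≟ᶠ x) ≡ true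
≟ᶠ-refl x = trans (isYes≗does (x ≟ᶠ x)) (dec-true (x ≟ᶠ x) refl)

≟ᶠ-sound : ∀ {n} (x y : Fin n) → isYes (x ≟ᶠ y) ≡ true → x ≡ y
≟ᶠ-sound x y holds = toWitness {a? = x ≟ᶠ y} (from T-≡ holds)

Reach : ∀ {n} → Graph n → ℕ → Fin n → Fin n → Set
Reach G m x y = reach G m x y ≡ true

module Walks {n} (G : Graph n) where

  lastEdge : ℕ → Fin n → Fin n → Bool
  lastEdge m x y = any (λ w → reach G m x w ∧ Adj G w y) (allFin n)

  reach-suc : ∀ m {x y} → Reach G m x y → Reach G (suc m) x y
  reach-suc m r rewrite r = refl

  reach-mono′ : ∀ {j k x y} → j ≤′ k → Reach G j x y → Reach G k x y
  reach-mono′ ≤′-refl r = r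
  reach-mono′ (≤′-step {k} j≤k) r = reach-suc k (reach-mono′ j≤k r)

  reach-mono : ∀ {j k x y} → j ≤ k → Reach G j x y → Reach G k x y
  reach-mono j≤k = reach-mono′ (≤⇒≤′ j≤k)

  reach-step : ∀ m {x y w} → Reach G m x y → Adj G y w ≡ true → Reach G (suc m) x w
  reach-step m {x} {y} {w} r yw with reach G m x w
  ... | true  = refl
  ... | false = any-allFin-intro (λ z → reach G m x z ∧ Adj G z w) y (cong₂ _∧_ r yw)

  reach-suc-inv : ∀ m {x y} → Reach G (suc m) x y →
    Reach G m x y ⊎ ∃ λ w → Reach G m x w × Adj G w y ≡ true
  reach-suc-inv m {x} {y} r with reach G m x y
  ... | true  = inj₁ refl
  ... | false = inj₂ (let (w , rw) = any-allFin-elim _ r in w , ∧-true rw)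

  reach-+ : ∀ a b {x y z} → Reach G a x y → Reach G b y z → Reach G (a + b) x z
  reach-+ a zero {x} {y} {z} rxy ryz
    rewrite +-identityʳ a | ≟ᶠ-sound y z ryz = rxy
  reach-+ a (suc b) rxy ryz rewrite +-suc a b with reach-suc-inv b ryz
  ... | inj₁ ryz′ = reach-suc (a + b) (reach-+ a b rxy ryz′)
  ... | inj₂ (w , ryw , wz) = reach-step (a + b) (reach-+ a b rxy ryw) wz

reach-subgraph : ∀ {m n} (H : Graph m) (G : Graph n) (ι : Fin m → Fin n) →
  IsSubgraph H G ι → ∀ j {u v} → Reach H j u v → Reach G j (ι u) (ι v)
reach-subgraph H G ι sub zero {u} {v} r rewrite ≟ᶠ-sound u v r = ≟ᶠ-refl (ι v)
reach-subgraph H G ι sub (suc j) {u} {v} r with Walks.reach-suc-inv H j r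
... | inj₁ r′ = Walks.reach-suc G j (reach-subgraph H G ι sub j r′)
... | inj₂ (w , ruw , wv) =
  Walks.reach-step G j (reach-subgraph H G ι sub j ruw) (proj₂ sub w v wv)

module Truncated {n} (G : Graph n) where
  open Walks G

  private
    if-≤ : ∀ b {p q r} → p ≤ r → q ≤ r → (if b then p else q) ≤ r
    if-≤ true  p≤r _   = p≤r
    if-≤ false _   q≤r = q≤r

  dtrunc-≤-suc : ∀ i x z → dtrunc G i x z ≤ suc i
  dtrunc-≤-suc zero x z = if-≤ (reach G zero x z) z≤n ≤-refl
  dtrunc-≤-suc (suc i) x z with reach G i x z
  ... | true  = m≤n⇒m≤1+n (dtrunc-≤-suc i x z)
  ... | false = if-≤ _ (n≤1+n (suc i)) ≤-refl

  dtrunc-≤-reach : ∀ i j x z → j ≤ i → Reach G j x z → dtrunc G i x z ≤ j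
  dtrunc-≤-reach zero zero x z _ r rewrite r = z≤n
  dtrunc-≤-reach (suc i) j x z j≤1+i r with reach G i x z in ri | j ≤? i
  ... | true  | yes j≤i = dtrunc-≤-reach i j x z j≤i r
  ... | true  | no  j≰i = ≤-trans (dtrunc-≤-suc i x z) (≰⇒> j≰i)
  ... | false | yes j≤i = contradiction (trans (≡-sym (reach-mono j≤i r)) ri) λ ()
  -- Remaining case j = i + 1: d(x,z) = i + 1 exactly, via a last edge.
  ... | false | no  j≰i with ≤-antisym j≤1+i (≰⇒> j≰i)
  ...   | refl rewrite subst (λ a → a ∨ lastEdge i x z ≡ true) ri r = ≤-refl

  dtrunc-reach : ∀ i x z → dtrunc G i x z ≤ i → Reach G (dtrunc G i x z) x z
  dtrunc-reach zero x z d≤0 with reach G zero x z in r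
  ... | true  = r
  ... | false = contradiction d≤0 λ ()
  dtrunc-reach (suc i) x z d≤1+i with reach G i x z in ri
  ... | true  = dtrunc-reach i x z (dtrunc-≤-reach i i x z ≤-refl ri)
  ... | false with lastEdge i x z in e
  ...   | true  = cong₂ _∨_ ri e
  ...   | false = contradiction d≤1+i 1+n≰n

  -- Either a
  -- side is at the cap i + 1, or d_i(b,z) is a true distance and a walk
  -- a ⇝ b ⇝ z of length d + d_i(b,z) ≤ i bounds d_i(a,z).
  dtrunc-triangle : ∀ i d a b z → Reach G d a b → dtrunc G i a z ≤ dtrunc G i b z + d
  dtrunc-triangle i d a b z rab with dtrunc G i b z ≤? i | d + dtrunc G i b z ≤? i
  ... | no  t≰i | _ =
    ≤-trans (dtrunc-≤-suc i a z) (≤-trans (≰⇒> t≰i) (m≤m+n _ d))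
  ... | yes t≤i | yes s≤i = subst (dtrunc G i a z ≤_) (+-comm d _)
    (dtrunc-≤-reach i _ a z s≤i (reach-+ d _ rab (dtrunc-reach i b z t≤i)))
  ... | yes _   | no  s≰i = subst (dtrunc G i a z ≤_) (+-comm d _)
    (≤-trans (dtrunc-≤-suc i a z) (≰⇒> s≰i))

minimum : ∀ {m} → (Fin (suc m) → ℕ) → ℕ
minimum {zero}  h = h fzero
minimum {suc m} h = h fzero ⊓ minimum (h ∘ fsuc)

minimum-≤ : ∀ {m} (h : Fin (suc m) → ℕ) x → minimum h ≤ h x
minimum-≤ {zero}  h fzero    = ≤-refl
minimum-≤ {suc m} h fzero    = m⊓n≤m _ _
minimum-≤ {suc m} h (fsuc x) = ≤-trans (m⊓n≤n _ _) (minimum-≤ (h ∘ fsuc) x)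

minimum-attained : ∀ {m} (h : Fin (suc m) → ℕ) → ∃ λ y → h y ≡ minimum h
minimum-attained {zero}  h = fzero , refl
minimum-attained {suc m} h with h fzero ≤? minimum (h ∘ fsuc)
... | yes h₀≤ = fzero , ≡-sym (m≤n⇒m⊓n≡m h₀≤)
... | no  h₀≰ with minimum-attained (h ∘ fsuc)
...   | y , hy = fsuc y , trans hy (≡-sym (m≥n⇒m⊓n≡n (<⇒≤ (≰⇒> h₀≰))))

∑ : ∀ {n} → (Fin n → ℕ) → ℕ
∑ {zero}  r = 0
∑ {suc n} r = r fzero + ∑ (r ∘ fsuc)

∏ : ∀ {n} → (Fin n → ℕ) → ℕ
∏ {zero}  r = 1
∏ {suc n} r = r fzero * ∏ (r ∘ fsuc)

sum-tabulate : ∀ {n} (r : Fin n → ℕ) → sum (tabulate r) ≡ ∑ r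
sum-tabulate {zero}  r = refl
sum-tabulate {suc n} r = cong (r fzero +_) (sum-tabulate (r ∘ fsuc))

cost≡∑ : ∀ {n} (f : Fin n → ℕ) → cost f ≡ ∑ f
cost≡∑ f = trans (cong sum (map-tabulate id f)) (sum-tabulate f)

encode : ∀ {n} → (Fin n → ℕ) → (Fin n → ℕ) → ℕ
encode {zero}  r g = 0
encode {suc n} r g = g fzero + r fzero * encode (r ∘ fsuc) (g ∘ fsuc)

radix-step-< : ∀ r {a a′ e e′} → a < r → e < e′ → a + r * e < a′ + r * e′
radix-step-< r {a} {a′} {e} {e′} a<r e<e′ = begin-strict
  a + r * e   <⟨ +-monoˡ-< (r * e) a<r ⟩
  r + r * e   ≡⟨ ≡-sym (*-suc r e) ⟩
  r * suc e   ≤⟨ *-monoʳ-≤ r e<e′ ⟩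
  r * e′      ≤⟨ m≤n+m (r * e′) a′ ⟩
  a′ + r * e′ ∎
  where open ≤-Reasoning

radix-step-unique : ∀ r {a a′ e e′} → a < r → a′ < r →
  a + r * e ≡ a′ + r * e′ → a ≡ a′ × e ≡ e′
radix-step-unique r {a} {a′} {e} {e′} a<r a′<r eq with <-cmp e e′
... | tri< e<e′ _ _ = contradiction eq (<⇒≢ (radix-step-< r a<r e<e′))
... | tri> _ _ e>e′ = contradiction (≡-sym eq) (<⇒≢ (radix-step-< r a′<r e>e′))
... | tri≈ _ refl _ = +-cancelʳ-≡ (r * e) a a′ eq , refl

encode-< : ∀ {n} (r g : Fin n → ℕ) → (∀ z → g z < r z) → encode r g < ∏ r
encode-< {zero}  r g g<r = s≤s z≤n
encode-< {suc n} r g g<r =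
  radix-step-< (r fzero) {a′ = 0} (g<r fzero) (encode-< (r ∘ fsuc) (g ∘ fsuc) (g<r ∘ fsuc))

encode-injective : ∀ {n} (r g g′ : Fin n → ℕ) → (∀ z → g z < r z) → (∀ z → g′ z < r z) →
  encode r g ≡ encode r g′ → ∀ z → g z ≡ g′ z
encode-injective {suc n} r g g′ g<r g′<r eq z
  with radix-step-unique (r fzero) (g<r fzero) (g′<r fzero) eq
encode-injective {suc n} r g g′ g<r g′<r eq fzero    | same-digit , _ = same-digit
encode-injective {suc n} r g g′ g<r g′<r eq (fsuc z) | _ , same-rest =
  encode-injective (r ∘ fsuc) (g ∘ fsuc) (g′ ∘ fsuc) (g<r ∘ fsuc) (g′<r ∘ fsuc) same-rest z

separated-≤-∏ : ∀ {m n} (r : Fin n → ℕ) (g : Fin m → Fin n → ℕ) →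
  (∀ x z → g x z < r z) → (∀ x y → (∀ z → g x z ≡ g y z) → x ≡ y) → m ≤ ∏ r
separated-≤-∏ {m} r g g<r separates = injective⇒≤ {f = code} code-injective
  where
    code : Fin m → Fin (∏ r)
    code x = fromℕ< (encode-< r (g x) (g<r x))
    code-injective : ∀ {x y} → code x ≡ code y → x ≡ y
    code-injective {x} {y} eq = separates x y (encode-injective r (g x) (g y) (g<r x) (g<r y)
      (fromℕ<-injective _ _ (encode-< r (g x) (g<r x)) (encode-< r (g y) (g<r y)) eq))

-- Digits contributed by a vertex broadcasting with strength c: none if c = 0
-- (radix 1), otherwise a value in 0..d (radix d+1).
radix : ℕ → ℕ → ℕ
radix d zero    = 1
radix d (suc _) = suc d

digit : ℕ → ℕ → ℕ
digit zero    _ = 0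
digit (suc _) v = v

digit-< : ∀ d c {v} → v ≤ d → digit c v < radix d c
digit-< d zero    _   = s≤s z≤n
digit-< d (suc c) v≤d = s≤s v≤d

digit-injective : ∀ c {a b} → 0 < c → digit c a ≡ digit c b → a ≡ b
digit-injective (suc c) _ eq = eq

radix-≤ : ∀ d c → radix d c ≤ suc d ^ c
radix-≤ d zero    = ≤-refl
radix-≤ d (suc c) = subst (_≤ suc d ^ suc c) (*-identityʳ (suc d))
  (*-monoʳ-≤ (suc d) (m^n>0 (suc d) c))

∏-radix-≤ : ∀ {n} d (f : Fin n → ℕ) → ∏ (radix d ∘ f) ≤ suc d ^ ∑ f
∏-radix-≤ {zero}  d f = ≤-refl
∏-radix-≤ {suc n} d f = begin
  radix d (f fzero) * ∏ (radix d ∘ f ∘ fsuc) ≤⟨ *-mono-≤ (radix-≤ d (f fzero)) (∏-radix-≤ d (f ∘ fsuc)) ⟩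
  suc d ^ f fzero * suc d ^ ∑ (f ∘ fsuc)     ≡⟨ ≡-sym (^-distribˡ-+-* (suc d) (f fzero) _) ⟩
  suc d ^ ∑ f                                ∎
  where open ≤-Reasoning

resolving-subgraph-bound : ∀ {n m} (G : Graph n) (f : Fin n → ℕ) → IsResolvingBroadcast G f →
  (H : Graph m) (ι : Fin m → Fin n) → IsSubgraph H G ι →
  (d : ℕ) → (∀ x y → Reach H d x y) → m ≤ suc d ^ cost f
resolving-subgraph-bound {m = zero} G f resolving H ι sub d close = z≤n
resolving-subgraph-bound {n} {suc m} G f resolving H ι sub d close = begin
  suc m           ≤⟨ separated-≤-∏ (radix d ∘ f) digits digits-< digits-separate ⟩
  ∏ (radix d ∘ f) ≤⟨ ∏-radix-≤ d f ⟩
  suc d ^ ∑ f     ≡⟨ cong (suc d ^_) (≡-sym (cost≡∑ f)) ⟩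
  suc d ^ cost f  ∎
  where
    open ≤-Reasoning
    open Truncated G using (dtrunc-triangle)

    profile : Fin n → Fin (suc m) → ℕ
    profile z x = dtrunc G (f z) (ι x) z

    lowest : Fin n → ℕ
    lowest z = minimum (profile z)

    spread : ∀ z x → profile z x ≤ lowest z + d
    spread z x with minimum-attained (profile z)
    ... | y , minimal = subst (λ l → profile z x ≤ l + d) minimal
      (dtrunc-triangle (f z) d (ι x) (ι y) z (reach-subgraph H G ι sub d (close x y)))

    digits : Fin (suc m) → Fin n → ℕ
    digits x z = digit (f z) (profile z x ∸ lowest z)

    digits-< : ∀ x z → digits x z < radix d (f z)
    digits-< x z = digit-< d (f z) (m≤n+o⇒m∸n≤o (profile z x) (lowest z) (spread z x))

    -- Distinct vertices are resolved by some z with f z > 0, at which their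
    -- digits differ; ι is injective, so equal images mean equal vertices.
    digits-separate : ∀ x y → (∀ z → digits x z ≡ digits y z) → x ≡ y
    digits-separate x y same with ι x ≟ᶠ ι y
    ... | yes ιx≡ιy = proj₁ sub ιx≡ιy
    ... | no  ιx≢ιy with resolving (ι x) (ι y) ιx≢ιy
    ...   | z , broadcasts , resolved = contradiction
      (∸-cancelʳ-≡ (minimum-≤ (profile z) x) (minimum-≤ (profile z) y)
        (digit-injective (f z) broadcasts (same z)))
      resolved

-- Corollary 3.5: if bdim(G) = k and H ⊆ G has diameter d, then |V(H)| ≤ (d+1)^k.
-- Apply the main bound to a resolving broadcast of cost k; only the upper
-- bound on distances in H is used.
corollary3p5 : ∀ {n m : ℕ} (G : Graph n) (k : ℕ) → BDim G k →
    (H : Graph m) (ι : Fin m → Fin n) → IsSubgraph H G ι →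
    (d : ℕ) → Diam H d → m ≤ (d + 1) ^ k
corollary3p5 G k ((f , resolving , cost≡k) , _) H ι sub d (close , _) =
  subst (_ ≤_) (cong₂ _^_ (+-comm 1 d) cost≡k)
    (resolving-subgraph-bound G f resolving H ι sub d close)
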